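{- Let $n,j$ be nonnegative integers. Then $$\sum_{k=j}^n\frac{\binom{2k}{k}\binom{k}{j}}{4^k}=\frac{n+1}{2^{2n+1}(2j+1)}\binom{n}{j}\binom{2n+2}{n+1}.$$ -}

module Defs where

open import Data.Nat using (ℕ; zero; suc; _^_; _*_; _+_; NonZero)
open import Data.Nat.Properties using (m^n≢0; m*n≢0)
open import Data.Nat.Combinatorics using (_C_)
open import Data.Integer using (+_)
open import Data.Rational using (ℚ; 0ℚ; _/_) renaming (_+_ to _+ℚ_)

-- Σ[k = j .. n] f k  as  Σ_{i=0}^{n-j} f (j+i);  empty (= 0) when j > n.
-- sumFromTo j n f = f j + f (j+1) + ... + f n
sumUpTo : ℕ → (ℕ → ℚ) → ℚ
sumUpTo zero    f = f 0
sumUpTo (suc m) f = sumUpTo m f +ℚ f (suc m)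

sumFromTo : ℕ → ℕ → (ℕ → ℚ) → ℚ
sumFromTo zero    n       f = sumUpTo n f
sumFromTo (suc j) zero    f = 0ℚ
sumFromTo (suc j) (suc n) f = sumFromTo j n (λ i → f (suc i))

summand : ℕ → ℕ → ℚ
summand j k = (+ (((2 * k) C k) * (k C j))) / (4 ^ k)
  where instance _ : NonZero (4 ^ k)
                 _ = m^n≢0 4 k

rhs : ℕ → ℕ → ℚ
rhs n j = (+ ((n + 1) * (n C j) * ((2 * n + 2) C (n + 1)))) / (2 ^ (2 * n + 1) * (2 * j + 1))
  where instance _ : NonZero (2 ^ (2 * n + 1) * (2 * j + 1))
                 _ = m*n≢0 (2 ^ (2 * n + 1)) (2 * j + 1) {{m^n≢0 2 (2 * n + 1)}} {{nz}}
                   where nz : NonZero (2 * j + 1)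
                         nz rewrite Data.Nat.Properties.+-comm (2 * j) 1 = _

module Submission where

-- Write B n = C(2n,n) for the central binomial coefficient.
-- Using (n+1) B (n+1) = 2 (2n+1) B n, the right-hand side becomes the
-- closed form  (2n+1) C(n,j) B n / (4^n (2j+1)),  and the identity is
-- proved by induction on n ≥ j: at n = j both sides are B j / 4^j, and
-- adding the next summand B (n+1) C(n+1,j) / 4^(n+1) to the closed form at
-- n gives the closed form at n+1.  After clearing denominators that step is
-- the integer identity
--   4 (2n+1) C(n,j) B n + (2j+1) C(n+1,j) B (n+1) = (2n+3) C(n+1,j) B (n+1),
-- a consequence of the recurrence for B and of the row recurrence
-- (n+1) C(n,j) + j C(n+1,j) = (n+1) C(n+1,j).  For n < j both sides vanish.

open import Defs
open import Data.Nat using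
  (ℕ; zero; suc; _+_; _*_; _^_; _∸_; _≤_; _<_; s≤s; _≤′_; ≤′-refl; ≤′-step; _≤?_; NonZero)
open import Data.Nat.Properties
open import Data.Nat.Combinatorics using
  (_C_; nC1≡n; nCk≡nC[n∸k]; k>n⇒nCk≡0) renaming (nCk+nC[k+1]≡[n+1]C[k+1] to pascal)
open import Data.Nat.Tactic.RingSolver using (solve-∀)
open import Data.Integer as ℤ using (+_)
open import Data.Integer.Properties using (pos-*; pos-+)
open import Data.Rational using (ℚ; _/_; 0ℚ; fromℚᵘ; toℚᵘ) renaming (_+_ to _+ℚ_)
open import Data.Rational.Properties using (fromℚᵘ-cong; fromℚᵘ-toℚᵘ; toℚᵘ-fromℚᵘ; toℚᵘ-homo-+; /-cong; 0/n≡0)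
open import Data.Rational.Unnormalised as ℚᵘ using (mkℚᵘ; *≡*)
import Data.Rational.Unnormalised.Properties as ℚᵘ
open import Relation.Nullary using (yes; no)
open import Relation.Binary.PropositionalEquality using (_≡_; refl; sym; trans; cong; cong₂; subst; module ≡-Reasoning)
open ≡-Reasoning

/-cross : ∀ a c x z .{{_ : NonZero x}} .{{_ : NonZero z}} →
          a * z ≡ c * x → (+ a) / x ≡ (+ c) / z
/-cross a c zero    z       {{()}}
/-cross a c (suc x) zero    {{_}} {{()}}
/-cross a c (suc x) (suc z) a*z≡c*x = fromℚᵘ-cong {mkℚᵘ (+ a) x} {mkℚᵘ (+ c) z} (*≡* (begin
  + a ℤ.* + suc z  ≡⟨ pos-* a (suc z) ⟨
  + (a * suc z)    ≡⟨ cong +_ a*z≡c*x ⟩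
  + (c * suc x)    ≡⟨ pos-* c (suc x) ⟩
  + c ℤ.* + suc x  ∎))

-- Addition of fractions of naturals by the schoolbook rule a/x + b/y = (ay + bx)/(xy).
-- It holds literally for unnormalised rationals; toℚᵘ transports it to ℚ.
/-+ : ∀ a b x y .{{_ : NonZero x}} .{{_ : NonZero y}} →
      (+ a) / x +ℚ (+ b) / y ≡ ((+ (a * y + b * x)) / (x * y)) {{m*n≢0 x y}}
/-+ a b zero    y       {{()}}
/-+ a b (suc x) zero    {{_}} {{()}}
/-+ a b (suc x) (suc y) = begin
  p +ℚ q
    ≡⟨ fromℚᵘ-toℚᵘ (p +ℚ q) ⟨
  fromℚᵘ (toℚᵘ (p +ℚ q))
    ≡⟨ fromℚᵘ-cong (ℚᵘ.≃-trans (toℚᵘ-homo-+ p q)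
                     (ℚᵘ.+-cong (toℚᵘ-fromℚᵘ (mkℚᵘ (+ a) x)) (toℚᵘ-fromℚᵘ (mkℚᵘ (+ b) y)))) ⟩
  fromℚᵘ (mkℚᵘ (+ a) x ℚᵘ.+ mkℚᵘ (+ b) y)
    ≡⟨ cong (λ i → i / (suc x * suc y)) numerator ⟨
  (+ (a * suc y + b * suc x)) / (suc x * suc y)  ∎
  where
  p = (+ a) / suc x
  q = (+ b) / suc y
  numerator : + (a * suc y + b * suc x) ≡ + a ℤ.* + suc y ℤ.+ + b ℤ.* + suc x
  numerator = trans (pos-+ (a * suc y) (b * suc x))
                    (cong₂ ℤ._+_ (pos-* a (suc y)) (pos-* b (suc x)))

sumFromTo-single : ∀ j (f : ℕ → ℚ) → sumFromTo j j f ≡ f j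
sumFromTo-single zero    f = refl
sumFromTo-single (suc j) f = sumFromTo-single j (λ i → f (suc i))

sumFromTo-snoc : ∀ j n (f : ℕ → ℚ) → j ≤ n →
                 sumFromTo j (suc n) f ≡ sumFromTo j n f +ℚ f (suc n)
sumFromTo-snoc zero    n       f _         = refl
sumFromTo-snoc (suc j) (suc n) f (s≤s j≤n) = sumFromTo-snoc j n (λ i → f (suc i)) j≤n

sumFromTo-empty : ∀ j n (f : ℕ → ℚ) → n < j → sumFromTo j n f ≡ 0ℚ
sumFromTo-empty (suc j) zero    f _         = refl
sumFromTo-empty (suc j) (suc n) f (s≤s n<j) = sumFromTo-empty j n (λ i → f (suc i)) n<j

absorption : ∀ m k → suc k * (suc m C suc k) ≡ suc m * (m C k)
absorption zero    zero    = refl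
absorption zero    (suc k) = *-zeroʳ (suc (suc k))
absorption (suc m) zero    = trans (+-identityʳ _) (trans (nC1≡n (suc (suc m))) (sym (*-identityʳ _)))
absorption (suc m) (suc k) = begin
  suc (suc k) * (suc (suc m) C suc (suc k))
    ≡⟨ cong (suc (suc k) *_) (pascal (suc m) (suc k)) ⟨
  suc (suc k) * (X + suc m C suc (suc k))
    ≡⟨ *-distribˡ-+ (suc (suc k)) X _ ⟩
  X + suc k * X + suc (suc k) * (suc m C suc (suc k))
    ≡⟨ cong₂ (λ u v → X + u + v) (absorption m k) (absorption m (suc k)) ⟩
  X + suc m * (m C k) + suc m * (m C suc k)
    ≡⟨ +-assoc X _ _ ⟩
  X + (suc m * (m C k) + suc m * (m C suc k))
    ≡⟨ cong (λ u → X + u) (*-distribˡ-+ (suc m) (m C k) (m C suc k)) ⟨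
  X + suc m * (m C k + m C suc k)
    ≡⟨ cong (λ u → X + suc m * u) (pascal m k) ⟩
  suc (suc m) * X  ∎
  where X = suc m C suc k

row-recurrence : ∀ n j → suc n * (n C j) + j * (suc n C j) ≡ suc n * (suc n C j)
row-recurrence n zero    = +-identityʳ _
row-recurrence n (suc j) = begin
  suc n * (n C suc j) + suc j * (suc n C suc j)  ≡⟨ cong (λ u → suc n * (n C suc j) + u) (absorption n j) ⟩
  suc n * (n C suc j) + suc n * (n C j)          ≡⟨ *-distribˡ-+ (suc n) (n C suc j) (n C j) ⟨
  suc n * (n C suc j + n C j)                    ≡⟨ cong (suc n *_) (+-comm (n C suc j) (n C j)) ⟩
  suc n * (n C j + n C suc j)                    ≡⟨ cong (suc n *_) (pascal n j) ⟩
  suc n * (suc n C suc j)                        ∎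

central : ℕ → ℕ
central n = (2 * n) C n

middle-symmetry : ∀ n → suc (2 * n) C n ≡ suc (2 * n) C suc n
middle-symmetry n = trans (nCk≡nC[n∸k] n≤row) (cong (suc (2 * n) C_) row∸n)
  where
  odd-split : ∀ m → suc (2 * m) ≡ m + suc m
  odd-split = solve-∀
  n≤row : n ≤ suc (2 * n)
  n≤row = ≤-trans (m≤m+n n (suc n)) (≤-reflexive (sym (odd-split n)))
  row∸n : suc (2 * n) ∸ n ≡ suc n
  row∸n = trans (cong (_∸ n) (odd-split n)) (m+n∸m≡n n (suc n))

central-recurrence : ∀ n → suc n * central (suc n) ≡ 2 * (suc (2 * n) * central n)
central-recurrence n = begin
  suc n * ((2 * suc n) C suc n)                       ≡⟨ cong (λ r → suc n * (r C suc n)) (*-suc 2 n) ⟩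
  suc n * (suc (suc (2 * n)) C suc n)                 ≡⟨ cong (suc n *_) (pascal (suc (2 * n)) n) ⟨
  suc n * (suc (2 * n) C n + suc (2 * n) C suc n)     ≡⟨ cong (λ t → suc n * (t + suc (2 * n) C suc n)) (middle-symmetry n) ⟩
  suc n * (suc (2 * n) C suc n + suc (2 * n) C suc n) ≡⟨ double (suc n) (suc (2 * n) C suc n) ⟩
  2 * (suc n * (suc (2 * n) C suc n))                 ≡⟨ cong (2 *_) (absorption (2 * n) n) ⟩
  2 * (suc (2 * n) * central n)                       ∎
  where double : ∀ a b → a * (b + b) ≡ 2 * (a * b)
        double = solve-∀

4^n*odd≢0 : ∀ n j → NonZero (4 ^ n * suc (2 * j))
4^n*odd≢0 n j = m*n≢0 (4 ^ n) (suc (2 * j)) {{m^n≢0 4 n}}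

two-pow-odd : ∀ n → 2 ^ (2 * n + 1) ≡ 2 * 4 ^ n
two-pow-odd n = begin
  2 ^ (2 * n + 1)      ≡⟨ ^-distribˡ-+-* 2 (2 * n) 1 ⟩
  2 ^ (2 * n) * 2 ^ 1  ≡⟨ cong (_* 2 ^ 1) (^-*-assoc 2 2 n) ⟨
  4 ^ n * 2 ^ 1        ≡⟨ *-comm (4 ^ n) 2 ⟩
  2 * 4 ^ n            ∎

closed-form : ℕ → ℕ → ℚ
closed-form n j = ((+ (suc (2 * n) * (n C j) * central n)) / (4 ^ n * suc (2 * j))) {{4^n*odd≢0 n j}}

-- The right-hand side of the theorem is the closed form, by the central recurrence.
rhs≡closed-form : ∀ n j → rhs n j ≡ closed-form n j
rhs≡closed-form n j =
  /-cross ((n + 1) * (n C j) * ((2 * n + 2) C (n + 1))) (suc (2 * n) * (n C j) * central n)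
          (2 ^ (2 * n + 1) * (2 * j + 1)) (4 ^ n * suc (2 * j))
          {{m*n≢0 _ _ {{m^n≢0 2 (2 * n + 1)}} {{odd≢0}}}} {{4^n*odd≢0 n j}} cross
  where
  odd≢0 : NonZero (2 * j + 1)
  odd≢0 = subst NonZero (+-comm 1 (2 * j)) _
  central-shift : (2 * n + 2) C (n + 1) ≡ central (suc n)
  central-shift = cong₂ _C_ (shift n) (+-comm n 1)
    where shift : ∀ n → 2 * n + 2 ≡ 2 * suc n
          shift = solve-∀
  regroup₁ : ∀ n c B′ P Q → (n + 1) * c * B′ * (P * Q) ≡ c * P * Q * (suc n * B′)
  regroup₁ = solve-∀
  regroup₂ : ∀ n j c B P → c * P * suc (2 * j) * (2 * (suc (2 * n) * B))
                          ≡ suc (2 * n) * c * B * (2 * P * (2 * j + 1))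
  regroup₂ = solve-∀
  cross : (n + 1) * (n C j) * ((2 * n + 2) C (n + 1)) * (4 ^ n * suc (2 * j))
        ≡ suc (2 * n) * (n C j) * central n * (2 ^ (2 * n + 1) * (2 * j + 1))
  cross = begin
    (n + 1) * (n C j) * ((2 * n + 2) C (n + 1)) * (4 ^ n * suc (2 * j))
      ≡⟨ cong (λ b → (n + 1) * (n C j) * b * (4 ^ n * suc (2 * j))) central-shift ⟩
    (n + 1) * (n C j) * central (suc n) * (4 ^ n * suc (2 * j))
      ≡⟨ regroup₁ n (n C j) (central (suc n)) (4 ^ n) (suc (2 * j)) ⟩
    (n C j) * 4 ^ n * suc (2 * j) * (suc n * central (suc n))
      ≡⟨ cong ((n C j) * 4 ^ n * suc (2 * j) *_) (central-recurrence n) ⟩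
    (n C j) * 4 ^ n * suc (2 * j) * (2 * (suc (2 * n) * central n))
      ≡⟨ regroup₂ n j (n C j) (central n) (4 ^ n) ⟩
    suc (2 * n) * (n C j) * central n * (2 * 4 ^ n * (2 * j + 1))
      ≡⟨ cong (λ d → suc (2 * n) * (n C j) * central n * (d * (2 * j + 1))) (two-pow-odd n) ⟨
    suc (2 * n) * (n C j) * central n * (2 ^ (2 * n + 1) * (2 * j + 1))  ∎

closed-form-diagonal : ∀ j → summand j j ≡ closed-form j j
closed-form-diagonal j =
  /-cross (central j * (j C j)) (suc (2 * j) * (j C j) * central j) (4 ^ j) (4 ^ j * suc (2 * j))
          {{m^n≢0 4 j}} {{4^n*odd≢0 j j}} (regroup (central j) (j C j) (4 ^ j) (suc (2 * j)))
  where regroup : ∀ B c P Q → B * c * (P * Q) ≡ Q * c * B * P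
        regroup = solve-∀

numerator-recurrence : ∀ n j →
  4 * (suc (2 * n) * (n C j) * central n) + central (suc n) * (suc n C j) * suc (2 * j)
  ≡ suc (2 * suc n) * (suc n C j) * central (suc n)
numerator-recurrence n j = begin
  4 * (suc (2 * n) * c₀ * B) + B′ * c₁ * suc (2 * j)  ≡⟨ regroup₁ (suc (2 * n)) c₀ B B′ c₁ (suc (2 * j)) ⟩
  2 * c₀ * (2 * (suc (2 * n) * B)) + B′ * c₁ * suc (2 * j)
    ≡⟨ cong (λ t → 2 * c₀ * t + B′ * c₁ * suc (2 * j)) (central-recurrence n) ⟨
  2 * c₀ * (suc n * B′) + B′ * c₁ * suc (2 * j)       ≡⟨ regroup₂ n j c₀ c₁ B′ ⟩
  B′ * (2 * (suc n * c₀ + j * c₁) + c₁)               ≡⟨ cong (λ t → B′ * (2 * t + c₁)) (row-recurrence n j) ⟩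
  B′ * (2 * (suc n * c₁) + c₁)                        ≡⟨ regroup₃ n c₁ B′ ⟩
  suc (2 * suc n) * c₁ * B′                           ∎
  where
  c₀ = n C j
  c₁ = suc n C j
  B  = central n
  B′ = central (suc n)
  regroup₁ : ∀ s c₀ B B′ c₁ Q → 4 * (s * c₀ * B) + B′ * c₁ * Q ≡ 2 * c₀ * (2 * (s * B)) + B′ * c₁ * Q
  regroup₁ = solve-∀
  regroup₂ : ∀ n j c₀ c₁ B′ → 2 * c₀ * (suc n * B′) + B′ * c₁ * suc (2 * j) ≡ B′ * (2 * (suc n * c₀ + j * c₁) + c₁)
  regroup₂ = solve-∀
  regroup₃ : ∀ n c₁ B′ → B′ * (2 * (suc n * c₁) + c₁) ≡ suc (2 * suc n) * c₁ * B′
  regroup₃ = solve-∀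

-- Clearing denominators in  a/(PQ) + b/(4P) = c/(4PQ)  reduces it to  4a + bQ = c.
clear-denominators : ∀ a b c P Q → 4 * a + b * Q ≡ c →
                     (a * (4 * P) + b * (P * Q)) * (4 * P * Q) ≡ c * (P * Q * (4 * P))
clear-denominators a b c P Q 4a+bQ≡c = begin
  (a * (4 * P) + b * (P * Q)) * (4 * P * Q)  ≡⟨ factor a b P Q ⟩
  (4 * a + b * Q) * (P * (4 * P * Q))        ≡⟨ cong (_* (P * (4 * P * Q))) 4a+bQ≡c ⟩
  c * (P * (4 * P * Q))                      ≡⟨ reorder c P Q ⟩
  c * (P * Q * (4 * P))                      ∎
  where
  factor : ∀ a b P Q → (a * (4 * P) + b * (P * Q)) * (4 * P * Q) ≡ (4 * a + b * Q) * (P * (4 * P * Q))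
  factor = solve-∀
  reorder : ∀ c P Q → c * (P * (4 * P * Q)) ≡ c * (P * Q * (4 * P))
  reorder = solve-∀

closed-form-step : ∀ n j → closed-form n j +ℚ summand j (suc n) ≡ closed-form (suc n) j
closed-form-step n j = begin
  closed-form n j +ℚ summand j (suc n)
    ≡⟨ /-+ a b x y {{4^n*odd≢0 n j}} {{m^n≢0 4 (suc n)}} ⟩
  ((+ (a * y + b * x)) / (x * y)) {{x*y≢0}}
    ≡⟨ /-cross (a * y + b * x) c (x * y) z {{x*y≢0}} {{4^n*odd≢0 (suc n) j}}
               (clear-denominators a b c (4 ^ n) (suc (2 * j)) (numerator-recurrence n j)) ⟩
  closed-form (suc n) j  ∎
  where
  a = suc (2 * n) * (n C j) * central n
  b = central (suc n) * (suc n C j)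
  c = suc (2 * suc n) * (suc n C j) * central (suc n)
  x = 4 ^ n * suc (2 * j)
  y = 4 ^ suc n
  z = 4 ^ suc n * suc (2 * j)
  x*y≢0 : NonZero (x * y)
  x*y≢0 = m*n≢0 x y {{4^n*odd≢0 n j}} {{m^n≢0 4 (suc n)}}

closed-form-vanishes : ∀ {n j} → n < j → closed-form n j ≡ 0ℚ
closed-form-vanishes {n} {j} n<j =
  trans (/-cong {{4^n*odd≢0 n j}} {{4^n*odd≢0 n j}} (cong +_ numerator≡0) refl) (0/n≡0 _ {{4^n*odd≢0 n j}})
  where
  numerator≡0 : suc (2 * n) * (n C j) * central n ≡ 0
  numerator≡0 = begin
    suc (2 * n) * (n C j) * central n  ≡⟨ cong (λ c → suc (2 * n) * c * central n) (k>n⇒nCk≡0 n<j) ⟩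
    suc (2 * n) * 0 * central n        ≡⟨ cong (_* central n) (*-zeroʳ (suc (2 * n))) ⟩
    0                                  ∎

partial-sum : ∀ {j n} → j ≤′ n → sumFromTo j n (summand j) ≡ closed-form n j
partial-sum {j} ≤′-refl = trans (sumFromTo-single j (summand j)) (closed-form-diagonal j)
partial-sum {j} (≤′-step {n} j≤′n) = begin
  sumFromTo j (suc n) (summand j)                ≡⟨ sumFromTo-snoc j n (summand j) (≤′⇒≤ j≤′n) ⟩
  sumFromTo j n (summand j) +ℚ summand j (suc n) ≡⟨ cong (_+ℚ summand j (suc n)) (partial-sum j≤′n) ⟩
  closed-form n j +ℚ summand j (suc n)           ≡⟨ closed-form-step n j ⟩
  closed-form (suc n) j                          ∎

lemma2p1 : (n j : ℕ) → sumFromTo j n (summand j) ≡ rhs n j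
lemma2p1 n j with j ≤? n
... | yes j≤n = trans (partial-sum (≤⇒≤′ j≤n)) (sym (rhs≡closed-form n j))
... | no j≰n = begin
  sumFromTo j n (summand j)  ≡⟨ sumFromTo-empty j n (summand j) n<j ⟩
  0ℚ                         ≡⟨ closed-form-vanishes n<j ⟨
  closed-form n j            ≡⟨ rhs≡closed-form n j ⟨
  rhs n j                    ∎
  where n<j = ≰⇒> j≰n
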